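{- If the sequent $\Gamma \vdash \Delta$ is provable in the classical sequent calculus then $\Gamma^{K^+}, \neg \Delta^{K^- } \vdash$ is provable in the intuitionistic sequent calculus.
   Context: First-order logic with connectives $\wedge,\vee,\Rightarrow,\neg$ and quantifiers $\forall,\exists$. The classical sequent calculus is the usual cut-free multi-conclusion sequent calculus (sequents $\Gamma\vdash\Delta$ of multisets, axiom $\Gamma,A\vdash A,\Delta$, left/right rules for each connective and quantifier, contraction and weakening on both sides, no cut). The intuitionistic sequent calculus is its cut-free restriction where the right-hand side contains at most one formula (no right contraction, $\Delta$ empty in the axiom and in the first premiss of $\Rightarrow_L$, and $\vee_R$ split into two rules choosing a disjunct). The polarized Kolmogorov translations are defined by induction: for $A$ atomic, $A^{K^+}\equiv A$ and $A^{K^- }\equiv A$; $(A\wedge B)^{K^+}\equiv A^{K^+}\wedge B^{K^+}$, $(A\wedge B)^{K^- }\equiv \neg\neg A^{K^- }\wedge\neg\neg B^{K^- }$; $(A\vee B)^{K^+}\equiv A^{K^+}\vee B^{K^+}$, $(A\vee B)^{K^- }\equiv \neg\neg A^{K^- }\vee\neg\neg B^{K^- }$; $(A\Rightarrow B)^{K^+}\equiv \neg\neg A^{K^- }\Rightarrow B^{K^+}$, $(A\Rightarrow B)^{K^- }\equiv A^{K^+}\Rightarrow\neg\neg B^{K^- }$; $(\neg A)^{K^+}\equiv\neg A^{K^- }$, $(\neg A)^{K^- }\equiv\neg A^{K^+}$; $(\forall x A)^{K^+}\equiv\forall x A^{K^+}$, $(\forall x A)^{K^- }\equiv\forall x\neg\neg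 A^{K^- }$; $(\exists x A)^{K^+}\equiv\exists x A^{K^+}$, $(\exists x A)^{K^- }\equiv\exists x\neg\neg A^{K^- }$. Translations and negations of multisets are applied formula by formula. -}

module Defs where

open import Data.Nat using (ℕ; zero; suc)
open import Data.List using (List; []; _∷_; map)
open import Data.Maybe using (Maybe; just; nothing)
open import Data.List.Relation.Binary.Permutation.Propositional using (_↭_)

-- First-order syntax (de Bruijn indices for bound/free variables).
-- Function and predicate symbols are named by natural numbers and are
-- applied to a list of arguments (an arbitrary first-order signature).

data Term : Set where
  var : ℕ → Term
  fun : ℕ → List Term → Term

infixr 6 _∧_
infixr 5 _∨_
infixr 4 _⇒_
infix  7 ¬_

data Formula : Set where
  atom : ℕ → List Term → Formula
  _∧_  : Formula → Formula → Formula
  _∨_  : Formula → Formula → Formula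
  _⇒_  : Formula → Formula → Formula
  ¬_   : Formula → Formula
  ∀'   : Formula → Formula
  ∃'   : Formula → Formula

mutual
  renT : (ℕ → ℕ) → Term → Term
  renT ρ (var n)    = var (ρ n)
  renT ρ (fun f ts) = fun f (renTs ρ ts)

  renTs : (ℕ → ℕ) → List Term → List Term
  renTs ρ []       = []
  renTs ρ (t ∷ ts) = renT ρ t ∷ renTs ρ ts

liftR : (ℕ → ℕ) → ℕ → ℕ
liftR ρ zero    = zero
liftR ρ (suc n) = suc (ρ n)

liftS : (ℕ → Term) → ℕ → Term
liftS σ zero    = var zero
liftS σ (suc n) = renT suc (σ n)

mutual
  subT : (ℕ → Term) → Term → Term
  subT σ (var n)    = σ n
  subT σ (fun f ts) = fun f (subTs σ ts)

  subTs : (ℕ → Term) → List Term → List Term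
  subTs σ []       = []
  subTs σ (t ∷ ts) = subT σ t ∷ subTs σ ts

subF : (ℕ → Term) → Formula → Formula
subF σ (atom p ts) = atom p (subTs σ ts)
subF σ (A ∧ B)     = subF σ A ∧ subF σ B
subF σ (A ∨ B)     = subF σ A ∨ subF σ B
subF σ (A ⇒ B)     = subF σ A ⇒ subF σ B
subF σ (¬ A)       = ¬ subF σ A
subF σ (∀' A)      = ∀' (subF (liftS σ) A)
subF σ (∃' A)      = ∃' (subF (liftS σ) A)

-- shift all free variables up by one (used for the eigenvariable condition:
-- the eigenvariable is the fresh index 0)
↑ : Formula → Formula
↑ = subF (λ n → var (suc n))

single : Term → ℕ → Term
single t zero    = t
single t (suc n) = var n

_[_] : Formula → Term → Formula
A [ t ] = subF (single t) A

-- Classical cut-free sequent calculus (multisets modelled by lists up to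
-- permutation; principal formulas are at the head).

infix 3 _⊢c_
data _⊢c_ : List Formula → List Formula → Set where
  ax    : ∀ {Γ Δ A} → A ∷ Γ ⊢c A ∷ Δ
  perm  : ∀ {Γ Γ' Δ Δ'} → Γ ↭ Γ' → Δ ↭ Δ' → Γ ⊢c Δ → Γ' ⊢c Δ'
  wL    : ∀ {Γ Δ A} → Γ ⊢c Δ → A ∷ Γ ⊢c Δ
  wR    : ∀ {Γ Δ A} → Γ ⊢c Δ → Γ ⊢c A ∷ Δ
  cL    : ∀ {Γ Δ A} → A ∷ A ∷ Γ ⊢c Δ → A ∷ Γ ⊢c Δ
  cR    : ∀ {Γ Δ A} → Γ ⊢c A ∷ A ∷ Δ → Γ ⊢c A ∷ Δ
  ∧L    : ∀ {Γ Δ A B} → A ∷ B ∷ Γ ⊢c Δ → (A ∧ B) ∷ Γ ⊢c Δ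
  ∧R    : ∀ {Γ Δ A B} → Γ ⊢c A ∷ Δ → Γ ⊢c B ∷ Δ → Γ ⊢c (A ∧ B) ∷ Δ
  ∨L    : ∀ {Γ Δ A B} → A ∷ Γ ⊢c Δ → B ∷ Γ ⊢c Δ → (A ∨ B) ∷ Γ ⊢c Δ
  ∨R    : ∀ {Γ Δ A B} → Γ ⊢c A ∷ B ∷ Δ → Γ ⊢c (A ∨ B) ∷ Δ
  ⇒L    : ∀ {Γ Δ A B} → Γ ⊢c A ∷ Δ → B ∷ Γ ⊢c Δ → (A ⇒ B) ∷ Γ ⊢c Δ
  ⇒R    : ∀ {Γ Δ A B} → A ∷ Γ ⊢c B ∷ Δ → Γ ⊢c (A ⇒ B) ∷ Δ
  ¬L    : ∀ {Γ Δ A} → Γ ⊢c A ∷ Δ → (¬ A) ∷ Γ ⊢c Δ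
  ¬R    : ∀ {Γ Δ A} → A ∷ Γ ⊢c Δ → Γ ⊢c (¬ A) ∷ Δ
  ∀L    : ∀ {Γ Δ A} (t : Term) → A [ t ] ∷ Γ ⊢c Δ → (∀' A) ∷ Γ ⊢c Δ
  ∀R    : ∀ {Γ Δ A} → map ↑ Γ ⊢c A ∷ map ↑ Δ → Γ ⊢c (∀' A) ∷ Δ
  ∃L    : ∀ {Γ Δ A} → A ∷ map ↑ Γ ⊢c map ↑ Δ → (∃' A) ∷ Γ ⊢c Δ
  ∃R    : ∀ {Γ Δ A} (t : Term) → Γ ⊢c A [ t ] ∷ Δ → Γ ⊢c (∃' A) ∷ Δ

-- Intuitionistic cut-free sequent calculus: right side has at most one
-- formula (Maybe Formula).

mapM : (Formula → Formula) → Maybe Formula → Maybe Formula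
mapM f nothing  = nothing
mapM f (just A) = just (f A)

infix 3 _⊢i_
data _⊢i_ : List Formula → Maybe Formula → Set where
  ax    : ∀ {Γ A} → A ∷ Γ ⊢i just A
  perm  : ∀ {Γ Γ' Δ} → Γ ↭ Γ' → Γ ⊢i Δ → Γ' ⊢i Δ
  wL    : ∀ {Γ Δ A} → Γ ⊢i Δ → A ∷ Γ ⊢i Δ
  wR    : ∀ {Γ A} → Γ ⊢i nothing → Γ ⊢i just A
  cL    : ∀ {Γ Δ A} → A ∷ A ∷ Γ ⊢i Δ → A ∷ Γ ⊢i Δ
  ∧L    : ∀ {Γ Δ A B} → A ∷ B ∷ Γ ⊢i Δ → (A ∧ B) ∷ Γ ⊢i Δ
  ∧R    : ∀ {Γ A B} → Γ ⊢i just A → Γ ⊢i just B → Γ ⊢i just (A ∧ B)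
  ∨L    : ∀ {Γ Δ A B} → A ∷ Γ ⊢i Δ → B ∷ Γ ⊢i Δ → (A ∨ B) ∷ Γ ⊢i Δ
  ∨R₁   : ∀ {Γ A B} → Γ ⊢i just A → Γ ⊢i just (A ∨ B)
  ∨R₂   : ∀ {Γ A B} → Γ ⊢i just B → Γ ⊢i just (A ∨ B)
  ⇒L    : ∀ {Γ Δ A B} → Γ ⊢i just A → B ∷ Γ ⊢i Δ → (A ⇒ B) ∷ Γ ⊢i Δ
  ⇒R    : ∀ {Γ A B} → A ∷ Γ ⊢i just B → Γ ⊢i just (A ⇒ B)
  ¬L    : ∀ {Γ A} → Γ ⊢i just A → (¬ A) ∷ Γ ⊢i nothing
  ¬R    : ∀ {Γ A} → A ∷ Γ ⊢i nothing → Γ ⊢i just (¬ A)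
  ∀L    : ∀ {Γ Δ A} (t : Term) → A [ t ] ∷ Γ ⊢i Δ → (∀' A) ∷ Γ ⊢i Δ
  ∀R    : ∀ {Γ A} → map ↑ Γ ⊢i just A → Γ ⊢i just (∀' A)
  ∃L    : ∀ {Γ Δ A} → A ∷ map ↑ Γ ⊢i mapM ↑ Δ → (∃' A) ∷ Γ ⊢i Δ
  ∃R    : ∀ {Γ A} (t : Term) → Γ ⊢i just (A [ t ]) → Γ ⊢i just (∃' A)

¬¬ : Formula → Formula
¬¬ A = ¬ (¬ A)

mutual
  K+ : Formula → Formula
  K+ (atom p ts) = atom p ts
  K+ (A ∧ B)     = K+ A ∧ K+ B
  K+ (A ∨ B)     = K+ A ∨ K+ B
  K+ (A ⇒ B)     = ¬¬ (K- A) ⇒ K+ B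
  K+ (¬ A)       = ¬ (K- A)
  K+ (∀' A)      = ∀' (K+ A)
  K+ (∃' A)      = ∃' (K+ A)

  K- : Formula → Formula
  K- (atom p ts) = atom p ts
  K- (A ∧ B)     = ¬¬ (K- A) ∧ ¬¬ (K- B)
  K- (A ∨ B)     = ¬¬ (K- A) ∨ ¬¬ (K- B)
  K- (A ⇒ B)     = K+ A ⇒ ¬¬ (K- B)
  K- (¬ A)       = ¬ (K+ A)
  K- (∀' A)      = ∀' (¬¬ (K- A))
  K- (∃' A)      = ∃' (¬¬ (K- A))

module Submission where

-- By induction on the classical derivation we show, more generally,
-- that   Γ ⊢c Δ  implies  map K+ Γ ++ Hs ⊢i nothing  whenever each formula of Δ is
-- "represented" by the corresponding hypothesis of Hs.  The hypothesis ¬ K- A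
-- represents A, and a representative of A ∨ B also represents A and B: from K- A
-- one proves K- (A ∨ B) = ¬¬ K- A ∨ ¬¬ K- B.  This invariant is what lets the
-- cut-free intuitionistic proof mimic the classical rule ∨R, which splits one right
-- formula into two; the only thing we ever do with a representative H of A is to
-- turn a proof of K- A under H into a refutation under H (lemma refute).
-- The theorem is the special case where every A in Δ is represented by ¬ K- A.

open import Defs
open import Data.List using (List; map; _++_; []; _∷_)
open import Data.List.Properties using (map-++)
open import Data.List.Relation.Binary.Pointwise using (Pointwise; []; _∷_)
import Data.List.Relation.Binary.Pointwise as Pointwise
open import Data.List.Relation.Binary.Permutation.Propositional
  using (_↭_; refl; prep; swap; trans; ↭-sym)
open import Data.List.Relation.Binary.Permutation.Propositional.Properties
  using (++⁺; shift)
import Data.List.Relation.Binary.Permutation.Propositional.Properties as Perm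
open import Data.Maybe using (nothing; just)
open import Data.Nat using (ℕ; zero; suc)
open import Data.Product using (∃; _×_; _,_)
open import Relation.Binary.PropositionalEquality
  using (_≡_; refl; sym; cong; cong₂; subst) renaming (trans to ≡-trans)

infix 4 _≗_
_≗_ : (ℕ → Term) → (ℕ → Term) → Set
σ ≗ τ = ∀ n → σ n ≡ τ n

up : ℕ → Term
up n = var (suc n)

mutual
  subT-ext : ∀ {σ τ} → σ ≗ τ → ∀ t → subT σ t ≡ subT τ t
  subT-ext e (var n)    = e n
  subT-ext e (fun f ts) = cong (fun f) (subTs-ext e ts)

  subTs-ext : ∀ {σ τ} → σ ≗ τ → ∀ ts → subTs σ ts ≡ subTs τ ts
  subTs-ext e []       = refl
  subTs-ext e (t ∷ ts) = cong₂ _∷_ (subT-ext e t) (subTs-ext e ts)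

liftS-ext : ∀ {σ τ} → σ ≗ τ → liftS σ ≗ liftS τ
liftS-ext e zero    = refl
liftS-ext e (suc n) = cong (renT suc) (e n)

subF-ext : ∀ {σ τ} → σ ≗ τ → ∀ A → subF σ A ≡ subF τ A
subF-ext e (atom p ts) = cong (atom p) (subTs-ext e ts)
subF-ext e (A ∧ B)     = cong₂ _∧_ (subF-ext e A) (subF-ext e B)
subF-ext e (A ∨ B)     = cong₂ _∨_ (subF-ext e A) (subF-ext e B)
subF-ext e (A ⇒ B)     = cong₂ _⇒_ (subF-ext e A) (subF-ext e B)
subF-ext e (¬ A)       = cong ¬_ (subF-ext e A)
subF-ext e (∀' A)      = cong ∀' (subF-ext (liftS-ext e) A)
subF-ext e (∃' A)      = cong ∃' (subF-ext (liftS-ext e) A)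

mutual
  subT-id : ∀ {σ} → σ ≗ var → ∀ t → subT σ t ≡ t
  subT-id e (var n)    = e n
  subT-id e (fun f ts) = cong (fun f) (subTs-id e ts)

  subTs-id : ∀ {σ} → σ ≗ var → ∀ ts → subTs σ ts ≡ ts
  subTs-id e []       = refl
  subTs-id e (t ∷ ts) = cong₂ _∷_ (subT-id e t) (subTs-id e ts)

liftS-id : ∀ {σ} → σ ≗ var → liftS σ ≗ var
liftS-id e zero    = refl
liftS-id e (suc n) = cong (renT suc) (e n)

subF-id : ∀ {σ} → σ ≗ var → ∀ A → subF σ A ≡ A
subF-id e (atom p ts) = cong (atom p) (subTs-id e ts)
subF-id e (A ∧ B)     = cong₂ _∧_ (subF-id e A) (subF-id e B)
subF-id e (A ∨ B)     = cong₂ _∨_ (subF-id e A) (subF-id e B)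
subF-id e (A ⇒ B)     = cong₂ _⇒_ (subF-id e A) (subF-id e B)
subF-id e (¬ A)       = cong ¬_ (subF-id e A)
subF-id e (∀' A)      = cong ∀' (subF-id (liftS-id e) A)
subF-id e (∃' A)      = cong ∃' (subF-id (liftS-id e) A)

-- Renaming followed by substitution, and substitution followed by renaming, are
-- single substitutions; both are needed to push a composition under a binder.
mutual
  subT-renT : ∀ σ ρ t → subT σ (renT ρ t) ≡ subT (λ n → σ (ρ n)) t
  subT-renT σ ρ (var n)    = refl
  subT-renT σ ρ (fun f ts) = cong (fun f) (subTs-renTs σ ρ ts)

  subTs-renTs : ∀ σ ρ ts → subTs σ (renTs ρ ts) ≡ subTs (λ n → σ (ρ n)) ts
  subTs-renTs σ ρ []       = refl
  subTs-renTs σ ρ (t ∷ ts) = cong₂ _∷_ (subT-renT σ ρ t) (subTs-renTs σ ρ ts)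

mutual
  renT-subT : ∀ ρ σ t → renT ρ (subT σ t) ≡ subT (λ n → renT ρ (σ n)) t
  renT-subT ρ σ (var n)    = refl
  renT-subT ρ σ (fun f ts) = cong (fun f) (renTs-subTs ρ σ ts)

  renTs-subTs : ∀ ρ σ ts → renTs ρ (subTs σ ts) ≡ subTs (λ n → renT ρ (σ n)) ts
  renTs-subTs ρ σ []       = refl
  renTs-subTs ρ σ (t ∷ ts) = cong₂ _∷_ (renT-subT ρ σ t) (renTs-subTs ρ σ ts)

_⊙_ : (ℕ → Term) → (ℕ → Term) → ℕ → Term
(σ ⊙ τ) n = subT σ (τ n)

mutual
  subT-comp : ∀ σ τ t → subT σ (subT τ t) ≡ subT (σ ⊙ τ) t
  subT-comp σ τ (var n)    = refl
  subT-comp σ τ (fun f ts) = cong (fun f) (subTs-comp σ τ ts)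

  subTs-comp : ∀ σ τ ts → subTs σ (subTs τ ts) ≡ subTs (σ ⊙ τ) ts
  subTs-comp σ τ []       = refl
  subTs-comp σ τ (t ∷ ts) = cong₂ _∷_ (subT-comp σ τ t) (subTs-comp σ τ ts)

liftS-comp : ∀ σ τ → liftS σ ⊙ liftS τ ≗ liftS (σ ⊙ τ)
liftS-comp σ τ zero    = refl
liftS-comp σ τ (suc n) =
  ≡-trans (subT-renT (liftS σ) suc (τ n)) (sym (renT-subT suc σ (τ n)))

subF-comp : ∀ σ τ A → subF σ (subF τ A) ≡ subF (σ ⊙ τ) A
subF-comp σ τ (atom p ts) = cong (atom p) (subTs-comp σ τ ts)
subF-comp σ τ (A ∧ B)     = cong₂ _∧_ (subF-comp σ τ A) (subF-comp σ τ B)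
subF-comp σ τ (A ∨ B)     = cong₂ _∨_ (subF-comp σ τ A) (subF-comp σ τ B)
subF-comp σ τ (A ⇒ B)     = cong₂ _⇒_ (subF-comp σ τ A) (subF-comp σ τ B)
subF-comp σ τ (¬ A)       = cong ¬_ (subF-comp σ τ A)
subF-comp σ τ (∀' A)      = cong ∀' (≡-trans (subF-comp (liftS σ) (liftS τ) A) (subF-ext (liftS-comp σ τ) A))
subF-comp σ τ (∃' A)      = cong ∃' (≡-trans (subF-comp (liftS σ) (liftS τ) A) (subF-ext (liftS-comp σ τ) A))

-- This is the shape of the premiss of
-- ∀R / ∃L after ↑ has passed a quantified hypothesis.
instantiate-shifted : ∀ A → subF (liftS up) A [ var zero ] ≡ A
instantiate-shifted A =
  ≡-trans (subF-comp (single (var zero)) (liftS up) A) (subF-id single-after-lift A)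
  where
  single-after-lift : single (var zero) ⊙ liftS up ≗ var
  single-after-lift zero    = refl
  single-after-lift (suc n) = refl

-- Both Kolmogorov translations commute with every substitution, since they only
-- insert connectives and leave atoms untouched.
mutual
  K+-sub : ∀ σ A → K+ (subF σ A) ≡ subF σ (K+ A)
  K+-sub σ (atom p ts) = refl
  K+-sub σ (A ∧ B)     = cong₂ _∧_ (K+-sub σ A) (K+-sub σ B)
  K+-sub σ (A ∨ B)     = cong₂ _∨_ (K+-sub σ A) (K+-sub σ B)
  K+-sub σ (A ⇒ B)     = cong₂ (λ X Y → ¬¬ X ⇒ Y) (K--sub σ A) (K+-sub σ B)
  K+-sub σ (¬ A)       = cong ¬_ (K--sub σ A)
  K+-sub σ (∀' A)      = cong ∀' (K+-sub (liftS σ) A)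
  K+-sub σ (∃' A)      = cong ∃' (K+-sub (liftS σ) A)

  K--sub : ∀ σ A → K- (subF σ A) ≡ subF σ (K- A)
  K--sub σ (atom p ts) = refl
  K--sub σ (A ∧ B)     = cong₂ (λ X Y → ¬¬ X ∧ ¬¬ Y) (K--sub σ A) (K--sub σ B)
  K--sub σ (A ∨ B)     = cong₂ (λ X Y → ¬¬ X ∨ ¬¬ Y) (K--sub σ A) (K--sub σ B)
  K--sub σ (A ⇒ B)     = cong₂ (λ X Y → X ⇒ ¬¬ Y) (K+-sub σ A) (K--sub σ B)
  K--sub σ (¬ A)       = cong ¬_ (K+-sub σ A)
  K--sub σ (∀' A)      = cong (λ X → ∀' (¬¬ X)) (K--sub (liftS σ) A)
  K--sub σ (∃' A)      = cong (λ X → ∃' (¬¬ X)) (K--sub (liftS σ) A)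

K+-shift : ∀ Γ Hs → map K+ (map ↑ Γ) ++ map ↑ Hs ≡ map ↑ (map K+ Γ ++ Hs)
K+-shift Γ Hs = ≡-trans (cong (_++ map ↑ Hs) (K+-shift-ctx Γ)) (sym (map-++ ↑ (map K+ Γ) Hs))
  where
  K+-shift-ctx : ∀ Γ → map K+ (map ↑ Γ) ≡ map ↑ (map K+ Γ)
  K+-shift-ctx []      = refl
  K+-shift-ctx (A ∷ Γ) = cong₂ _∷_ (K+-sub up A) (K+-shift-ctx Γ)

to-front : ∀ xs {H ys M} → xs ++ H ∷ ys ⊢i M → H ∷ xs ++ ys ⊢i M
to-front xs {H} {ys} = perm (shift H xs ys)

from-front : ∀ xs {H ys M} → H ∷ xs ++ ys ⊢i M → xs ++ H ∷ ys ⊢i M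
from-front xs {H} {ys} = perm (↭-sym (shift H xs ys))

wL-under : ∀ {C H Θ M} → C ∷ Θ ⊢i M → C ∷ H ∷ Θ ⊢i M
wL-under {C} {H} d = perm (swap H C refl) (wL d)

contract-middle : ∀ xs {H ys M} → xs ++ H ∷ H ∷ ys ⊢i M → xs ++ H ∷ ys ⊢i M
contract-middle xs {H} d = from-front xs (cL (to-front (H ∷ xs) (to-front xs d)))

¬¬-intro : ∀ {Θ C} → Θ ⊢i just C → Θ ⊢i just (¬¬ C)
¬¬-intro d = ¬R (¬L d)

K+⊢K- : ∀ A Θ → K+ A ∷ Θ ⊢i just (K- A)
K+⊢K- (atom p ts) Θ = ax
K+⊢K- (A ∧ B) Θ =
  ∧L (∧R (¬¬-intro (K+⊢K- A (K+ B ∷ Θ)))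
         (¬¬-intro (perm (swap (K+ B) (K+ A) refl) (K+⊢K- B (K+ A ∷ Θ)))))
K+⊢K- (A ∨ B) Θ = ∨L (∨R₁ (¬¬-intro (K+⊢K- A Θ))) (∨R₂ (¬¬-intro (K+⊢K- B Θ)))
K+⊢K- (A ⇒ B) Θ =
  ⇒R (perm (swap (¬¬ (K- A) ⇒ K+ B) (K+ A) refl)
           (⇒L (¬¬-intro (K+⊢K- A Θ)) (¬¬-intro (K+⊢K- B (K+ A ∷ Θ)))))
K+⊢K- (¬ A) Θ = ¬R (perm (swap (¬ K- A) (K+ A) refl) (¬L (K+⊢K- A Θ)))
K+⊢K- (∀' A) Θ =
  ∀R (∀L (var zero) (subst (λ F → F ∷ map ↑ Θ ⊢i just (¬¬ (K- A)))
                           (sym (instantiate-shifted (K+ A)))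
                           (¬¬-intro (K+⊢K- A (map ↑ Θ)))))
K+⊢K- (∃' A) Θ =
  ∃L (∃R (var zero) (subst (λ F → K+ A ∷ map ↑ Θ ⊢i just F)
                           (sym (instantiate-shifted (¬¬ (K- A))))
                           (¬¬-intro (K+⊢K- A (map ↑ Θ)))))

-- The canonical
-- representative of A is ¬ K- A; a representative of A ∨ B represents both
-- disjuncts, which is what the classical rule ∨R requires.
data Rep : Formula → Formula → Set where
  neg   : ∀ {A} → Rep A (¬ K- A)
  left  : ∀ {A B H} → Rep (A ∨ B) H → Rep A H
  right : ∀ {A B H} → Rep (A ∨ B) H → Rep B H

Reps : List Formula → List Formula → Set
Reps = Pointwise Rep

refute : ∀ {A H Θ} → Rep A H → H ∷ Θ ⊢i just (K- A) → H ∷ Θ ⊢i nothing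
refute neg       d = cL (¬L d)
refute (left r)  d = refute r (∨R₁ (¬¬-intro d))
refute (right r) d = refute r (∨R₂ (¬¬-intro d))

Rep-sub : ∀ σ {A H} → Rep A H → Rep (subF σ A) (subF σ H)
Rep-sub σ {A} neg = subst (λ F → Rep (subF σ A) (¬ F)) (K--sub σ A) neg
Rep-sub σ (left r)  = left (Rep-sub σ r)
Rep-sub σ (right r) = right (Rep-sub σ r)

Reps-shift : ∀ {Δ Hs} → Reps Δ Hs → Reps (map ↑ Δ) (map ↑ Hs)
Reps-shift rs = Pointwise.map⁺ ↑ ↑ (Pointwise.map (Rep-sub up) rs)

Reps-neg : ∀ Δ → Reps Δ (map (λ A → ¬ K- A) Δ)
Reps-neg []      = []
Reps-neg (A ∷ Δ) = neg ∷ Reps-neg Δ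

Pointwise-↭ : ∀ {a b r} {X : Set a} {Y : Set b} {R : X → Y → Set r} {xs xs' ys'} →
              xs ↭ xs' → Pointwise R xs' ys' →
              ∃ λ ys → Pointwise R xs ys × ys ↭ ys'
Pointwise-↭ {ys' = ys'} refl rs = ys' , rs , refl
Pointwise-↭ (prep x p) (r ∷ rs) with Pointwise-↭ p rs
... | ys , rs' , q = _ ∷ ys , r ∷ rs' , prep _ q
Pointwise-↭ (swap x y p) (r₁ ∷ r₂ ∷ rs) with Pointwise-↭ p rs
... | ys , rs' , q = _ ∷ _ ∷ ys , r₂ ∷ r₁ ∷ rs' , swap _ _ q
Pointwise-↭ (trans p q) rs with Pointwise-↭ q rs
... | ys₁ , rs₁ , q₁ with Pointwise-↭ p rs₁
... | ys₀ , rs₀ , p₀ = ys₀ , rs₀ , trans p₀ q₁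

-- A classical right rule with principal formula A represented by H is simulated by
-- proving K- A under H and refuting H; the representative is then put back in place.
close-right : ∀ Γ {A H Hs} → Rep A H → H ∷ map K+ Γ ++ Hs ⊢i just (K- A) →
              map K+ Γ ++ H ∷ Hs ⊢i nothing
close-right Γ r d = from-front (map K+ Γ) (refute r d)

¬¬-under : ∀ {C H Θ} → ¬ C ∷ Θ ⊢i nothing → H ∷ Θ ⊢i just (¬¬ C)
¬¬-under d = ¬R (wL-under d)

shift-context : ∀ Γ Hs {C} → C ∷ map K+ (map ↑ Γ) ++ map ↑ Hs ⊢i nothing →
                C ∷ map ↑ (map K+ Γ ++ Hs) ⊢i nothing
shift-context Γ Hs {C} = subst (λ Θ → C ∷ Θ ⊢i nothing) (K+-shift Γ Hs)

translate : ∀ {Γ Δ} → Γ ⊢c Δ → ∀ {Hs} → Reps Δ Hs → map K+ Γ ++ Hs ⊢i nothing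
translate (ax {Γ} {A = A}) (r ∷ rs) = close-right (A ∷ Γ) r (wL (K+⊢K- A _))
translate (perm p q d) rs with Pointwise-↭ q rs
... | _ , rs' , q' = perm (++⁺ (Perm.map⁺ K+ p) q') (translate d rs')
translate (wL d) rs = wL (translate d rs)
translate (wR {Γ} d) (r ∷ rs) = from-front (map K+ Γ) (wL (translate d rs))
translate (cL d) rs = cL (translate d rs)
translate (cR {Γ} d) (r ∷ rs) = contract-middle (map K+ Γ) (translate d (r ∷ r ∷ rs))
translate (∧L d) rs = ∧L (translate d rs)
translate (∧R {Γ} d₁ d₂) (r ∷ rs) =
  close-right Γ r (∧R (¬¬-under (to-front (map K+ Γ) (translate d₁ (neg ∷ rs))))
                      (¬¬-under (to-front (map K+ Γ) (translate d₂ (neg ∷ rs)))))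
translate (∨L d₁ d₂) rs = ∨L (translate d₁ rs) (translate d₂ rs)
translate (∨R {Γ} d) (r ∷ rs) =
  contract-middle (map K+ Γ) (translate d (left r ∷ right r ∷ rs))
translate (⇒L {Γ} d₁ d₂) rs =
  ⇒L (¬R (to-front (map K+ Γ) (translate d₁ (neg ∷ rs)))) (translate d₂ rs)
translate (⇒R {Γ} {A = A} d) (_∷_ {y = H} r rs) =
  close-right Γ r (⇒R (perm (swap H (K+ A) refl)
    (¬¬-under (to-front (K+ A ∷ map K+ Γ) (translate d (neg ∷ rs))))))
translate (¬L {Γ} d) rs = to-front (map K+ Γ) (translate d (neg ∷ rs))
translate (¬R {Γ} d) (r ∷ rs) = close-right Γ r (¬R (wL-under (translate d rs)))
translate (∀L {Γ} {A = A} t d) {Hs} rs =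
  ∀L t (subst (λ F → F ∷ map K+ Γ ++ Hs ⊢i nothing) (K+-sub (single t) A) (translate d rs))
translate (∀R {Γ} d) (_∷_ {ys = Hs} r rs) =
  close-right Γ r (∀R (¬¬-under (shift-context Γ Hs
    (to-front (map K+ (map ↑ Γ)) (translate d (neg ∷ Reps-shift rs))))))
translate (∃L {Γ} d) {Hs} rs = ∃L (shift-context Γ Hs (translate d (Reps-shift rs)))
translate (∃R {Γ} {A = A} t d) (_∷_ {ys = Hs} r rs) =
  close-right Γ r (∃R t (¬¬-under (subst (λ F → ¬ F ∷ map K+ Γ ++ Hs ⊢i nothing) (K--sub (single t) A)
    (to-front (map K+ Γ) (translate d (neg ∷ rs))))))

theorem1 : (Γ Δ : List Formula) → Γ ⊢c Δ →
    map K+ Γ ++ map (λ A → ¬ K- A) Δ ⊢i nothing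
theorem1 Γ Δ d = translate d (Reps-neg Δ)
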